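{- (Tarski's Axiom A in higher-order Tarski–Grothendieck set theory.) For each set $N$ there exists a set $M$ such that: (1) $N\in M$; (2) for every $X\in M$ and every $Y\subseteq X$, $Y\in M$; (3) for every $X\in M$ there is $Z\in M$ such that every $Y\subseteq X$ satisfies $Y\in Z$; (4) for every $X\subseteq M$, either there is a function $f:\iota\to\iota$ that is a bijection taking $X$ onto $M$, or $X\in M$.
   Context: The ambient theory (higher-order Tarski–Grothendieck set theory) is a classical extensional simple type theory with base type $\iota$ of sets, a choice operator at every type, and set-theoretic primitives: empty set, union, power set $\wp$, replacement $\{F x\mid x\in X\}$ for $F:\iota\to\iota$, set extensionality, $\in$-induction, and a universe operator $\mathsf{UnivOf}$ such that for every $N$: $N\in\mathsf{UnivOf}\,N$, $\mathsf{UnivOf}\,N$ is transitive and ZF-closed, and $\mathsf{UnivOf}\,N\subseteq U$ for every transitive ZF-closed $U$ with $N\in U$. (Transitive: every element is a subset. ZF-closed: closed under $\bigcup$, $\wp$, and replacement by any $F:\iota\to\iota$ mapping elements into the set.) "$f$ is a bijection taking $X$ onto $M$" means: $f u\in M$ for $u\in X$; $f$ is injective on $X$; and every element of $M$ is $f u$ for some $u\in X$. -}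

module Defs where

open import Data.Product using (Σ; ∃; _×_; _,_)
open import Data.Sum using (_⊎_)
open import Relation.Nullary using (¬_)
open import Relation.Binary.PropositionalEquality using (_≡_)

module SetNotions {ι : Set} (_∈_ : ι → ι → Set) where

  infix 4 _⊆_
  _⊆_ : ι → ι → Set
  X ⊆ Y = ∀ x → x ∈ X → x ∈ Y

  TransitiveSet : ι → Set
  TransitiveSet U = ∀ X → X ∈ U → X ⊆ U

  ZFClosed : (⋃ ℘ : ι → ι) (Repl : ι → (ι → ι) → ι) → ι → Set
  ZFClosed ⋃ ℘ Repl U =
      (∀ X → X ∈ U → ⋃ X ∈ U)
    × (∀ X → X ∈ U → ℘ X ∈ U)
    × (∀ X → X ∈ U → ∀ (F : ι → ι) → (∀ x → x ∈ X → F x ∈ U) → Repl X F ∈ U)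

  BijOnto : (ι → ι) → ι → ι → Set
  BijOnto f X M =
      (∀ u → u ∈ X → f u ∈ M)
    × (∀ u v → u ∈ X → v ∈ X → f u ≡ f v → u ≡ v)
    × (∀ w → w ∈ M → ∃ λ u → u ∈ X × w ≡ f u)

-- A model of higher-order Tarski–Grothendieck set theory: base type ι of sets,
-- Agda types as propositions, with classical logic and choice assumed.
record HOTG : Set₁ where
  field
    ι      : Set
    _∈_    : ι → ι → Set
    ∅      : ι
    ⋃      : ι → ι
    ℘      : ι → ι
    Repl   : ι → (ι → ι) → ι
    UnivOf : ι → ι

  open SetNotions _∈_

  field
    lem       : (P : Set) → P ⊎ ¬ P
    ε         : {A : Set} → A → (A → Set) → A
    ε-spec    : {A : Set} (a : A) (P : A → Set) (x : A) → P x → P (ε a P)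
    ∅-ax      : ∀ x → ¬ (x ∈ ∅)
    ⋃-ax₁     : ∀ X x → x ∈ ⋃ X → ∃ λ Y → x ∈ Y × Y ∈ X
    ⋃-ax₂     : ∀ X x Y → x ∈ Y → Y ∈ X → x ∈ ⋃ X
    ℘-ax₁     : ∀ X Y → Y ∈ ℘ X → Y ⊆ X
    ℘-ax₂     : ∀ X Y → Y ⊆ X → Y ∈ ℘ X
    Repl-ax₁  : ∀ X (F : ι → ι) y → y ∈ Repl X F → ∃ λ x → x ∈ X × y ≡ F x
    Repl-ax₂  : ∀ X (F : ι → ι) x → x ∈ X → F x ∈ Repl X F
    set-ext   : ∀ X Y → X ⊆ Y → Y ⊆ X → X ≡ Y
    ∈-ind     : (P : ι → Set) → (∀ X → (∀ x → x ∈ X → P x) → P X) → ∀ X → P X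
    UnivOf-in    : ∀ N → N ∈ UnivOf N
    UnivOf-trans : ∀ N → TransitiveSet (UnivOf N)
    UnivOf-ZF    : ∀ N → ZFClosed ⋃ ℘ Repl (UnivOf N)
    UnivOf-min   : ∀ N U → TransitiveSet U → ZFClosed ⋃ ℘ Repl U → N ∈ U → UnivOf N ⊆ U

module Submission where

-- Tarski's Axiom A holds for M = UnivOf N.  Properties (1)-(3) are immediate
-- from N ∈ UnivOf N, transitivity and closure under ℘.  The substance is (4),
-- which holds for EVERY transitive ZF-closed set U: a subset X ⊆ U that is
-- not a member of U is equinumerous with U.
-- Writing On(U) for the ordinals that are members of U, the argument is:
--   * Burali-Forti: On(U) is a set but not a member of U, so On(U) does not
--     inject into any member of U.
--   * Choosing "fresh" elements by transfinite recursion along On(U) gives an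
--     injection of On(U) into any class from which members of U never exhaust
--     the candidates.  Applied to X (since X ∉ U) this gives On(U) ↪ X; applied
--     to U itself, always choosing a new element of least rank in the cumulative
--     hierarchy, it gives an enumeration On(U) → U which Burali-Forti forces to
--     be onto.  Composing, U ↪ X.
--   * Schröder–Bernstein for the pair X ⊆ U, U ↪ X yields the bijection X → U.

open import Defs
open import Data.Product using (∃; _×_; _,_; proj₁; proj₂)
open import Data.Sum using (_⊎_; inj₁; inj₂)
open import Data.Empty using (⊥; ⊥-elim)
open import Relation.Nullary using (¬_)
open import Relation.Binary.PropositionalEquality using (_≡_; refl; sym; trans; cong; subst)

module SetTheory (T : HOTG) where
  open HOTG T
  open SetNotions _∈_

  dne : (P : Set) → ¬ ¬ P → P
  dne P ¬¬p with lem P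
  ... | inj₁ p = p
  ... | inj₂ ¬p = ⊥-elim (¬¬p ¬p)

  choose : (P : ι → Set) → ∃ P → P (ε ∅ P)
  choose P (x , px) = ε-spec ∅ P x px

  InjectiveOn : (ι → Set) → (ι → ι) → Set
  InjectiveOn P f = ∀ x y → P x → P y → f x ≡ f y → x ≡ y

  ∈-irrefl : ∀ x → ¬ (x ∈ x)
  ∈-irrefl = ∈-ind (λ x → ¬ (x ∈ x)) (λ x ih x∈x → ih x x∈x x∈x)

  ∈-minimal : (P : ι → Set) → ∀ y → P y → ∃ λ z → P z × (∀ w → w ∈ z → ¬ P w)
  ∈-minimal P = ∈-ind (λ y → P y → ∃ λ z → P z × (∀ w → w ∈ z → ¬ P w)) step
    where
    step : ∀ y → (∀ x → x ∈ y → P x → ∃ λ z → P z × (∀ w → w ∈ z → ¬ P w)) →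
           P y → ∃ λ z → P z × (∀ w → w ∈ z → ¬ P w)
    step y ih py with lem (∃ λ w → w ∈ y × P w)
    ... | inj₁ (w , w∈y , pw) = ih w w∈y pw
    ... | inj₂ none = y , py , λ w w∈y pw → none (w , w∈y , pw)

  Repl-all : ∀ X (F : ι → ι) (P : ι → Set) → (∀ x → x ∈ X → P (F x)) → ∀ y → y ∈ Repl X F → P y
  Repl-all X F P all y y∈ with Repl-ax₁ X F y y∈
  ... | x , x∈ , refl = all x x∈

  Repl-pointwise-⊆ : ∀ X (F G : ι → ι) → (∀ x → x ∈ X → F x ≡ G x) → Repl X F ⊆ Repl X G
  Repl-pointwise-⊆ X F G F≗G = Repl-all X F (λ y → y ∈ Repl X G)
    (λ x x∈ → subst (λ z → z ∈ Repl X G) (sym (F≗G x x∈)) (Repl-ax₂ X G x x∈))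

  Repl-cong : ∀ X (F G : ι → ι) → (∀ x → x ∈ X → F x ≡ G x) → Repl X F ≡ Repl X G
  Repl-cong X F G F≗G =
    set-ext _ _ (Repl-pointwise-⊆ X F G F≗G) (Repl-pointwise-⊆ X G F (λ x x∈ → sym (F≗G x x∈)))

  module ∈-Recursion (step : ι → ι) where
    data Graph : ι → ι → Set where
      graph : ∀ u (h : ι → ι) → (∀ v → v ∈ u → Graph v (h v)) → Graph u (step (Repl u h))

    graph-functional : ∀ u y y' → Graph u y → Graph u y' → y ≡ y'
    graph-functional = ∈-ind (λ u → ∀ y y' → Graph u y → Graph u y' → y ≡ y') ind
      where
      ind : ∀ u → (∀ v → v ∈ u → ∀ y y' → Graph v y → Graph v y' → y ≡ y') →
            ∀ y y' → Graph u y → Graph u y' → y ≡ y'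
      ind u ih _ _ (graph .u h g) (graph .u h' g') =
        cong step (Repl-cong u h h' (λ v v∈ → ih v v∈ (h v) (h' v) (g v v∈) (g' v v∈)))

    graph-total : ∀ u → ∃ (Graph u)
    graph-total = ∈-ind (λ u → ∃ (Graph u)) ind
      where
      ind : ∀ u → (∀ v → v ∈ u → ∃ (Graph v)) → ∃ (Graph u)
      ind u ih = _ , graph u (λ v → ε ∅ (Graph v)) (λ v v∈ → choose (Graph v) (ih v v∈))

    rec : ι → ι
    rec u = ε ∅ (Graph u)

    rec-graph : ∀ u → Graph u (rec u)
    rec-graph u = choose (Graph u) (graph-total u)

    rec-eq : ∀ u → rec u ≡ step (Repl u rec)
    rec-eq u with rec u | rec-graph u
    ... | .(step (Repl u h)) | graph .u h g =
      cong step (Repl-cong u h rec (λ v v∈ → graph-functional v _ _ (g v v∈) (rec-graph v)))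

  singleton : ι → ι
  singleton x = Repl (℘ ∅) (λ _ → x)

  singleton-in : ∀ x → x ∈ singleton x
  singleton-in x = Repl-ax₂ (℘ ∅) (λ _ → x) ∅ (℘-ax₂ ∅ ∅ (λ _ x∈ → x∈))

  singleton-eq : ∀ x y → y ∈ singleton x → y ≡ x
  singleton-eq x y y∈ = proj₂ (proj₂ (Repl-ax₁ (℘ ∅) (λ _ → x) y y∈))

  selector : (P : ι → Set) → ι → ι
  selector P x with lem (P x)
  ... | inj₁ _ = singleton x
  ... | inj₂ _ = ∅

  sep : ι → (ι → Set) → ι
  sep A P = ⋃ (Repl A (selector P))

  sep-in : ∀ A P x → x ∈ A → P x → x ∈ sep A P
  sep-in A P x x∈ px = ⋃-ax₂ _ x (selector P x) selected (Repl-ax₂ A (selector P) x x∈)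
    where
    selected : x ∈ selector P x
    selected with lem (P x)
    ... | inj₁ _ = singleton-in x
    ... | inj₂ ¬px = ⊥-elim (¬px px)

  sep-out : ∀ A P x → x ∈ sep A P → x ∈ A × P x
  sep-out A P x x∈ with ⋃-ax₁ _ x x∈
  ... | Y , x∈Y , Y∈ with Repl-ax₁ A (selector P) Y Y∈
  ... | a , a∈ , refl = selected x∈Y
    where
    selected : x ∈ selector P a → x ∈ A × P x
    selected x∈sel with lem (P a)
    ... | inj₂ _ = ⊥-elim (∅-ax x x∈sel)
    ... | inj₁ pa with singleton-eq a x x∈sel
    ...   | refl = a∈ , pa

  Ord : ι → Set
  Ord α = TransitiveSet α × (∀ β → β ∈ α → TransitiveSet β)

  Ord-el : ∀ α β → Ord α → β ∈ α → Ord β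
  Ord-el α β (α-tr , el-tr) β∈ = el-tr β β∈ , λ γ γ∈β → el-tr γ (α-tr β β∈ γ γ∈β)

  Trichotomous : ι → ι → Set
  Trichotomous α β = α ∈ β ⊎ (α ≡ β ⊎ β ∈ α)

  trichotomy : ∀ α β → Ord α → Ord β → Trichotomous α β
  trichotomy = ∈-ind (λ α → ∀ β → Ord α → Ord β → Trichotomous α β) outer
    where
    outer : ∀ α → (∀ γ → γ ∈ α → ∀ β → Ord γ → Ord β → Trichotomous γ β) →
            ∀ β → Ord α → Ord β → Trichotomous α β
    outer α ihα = ∈-ind (λ β → Ord α → Ord β → Trichotomous α β) inner
      where
      inner : ∀ β → (∀ δ → δ ∈ β → Ord α → Ord δ → Trichotomous α δ) →
              Ord α → Ord β → Trichotomous α β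
      inner β ihβ oα oβ with lem (α ∈ β) | lem (β ∈ α)
      ... | inj₁ α∈β | _ = inj₁ α∈β
      ... | inj₂ _ | inj₁ β∈α = inj₂ (inj₂ β∈α)
      ... | inj₂ α∉β | inj₂ β∉α = inj₂ (inj₁ (set-ext α β α⊆β β⊆α))
        where
        α⊆β : α ⊆ β
        α⊆β γ γ∈ with ihα γ γ∈ β (Ord-el α γ oα γ∈) oβ
        ... | inj₁ γ∈β = γ∈β
        ... | inj₂ (inj₁ refl) = ⊥-elim (β∉α γ∈)
        ... | inj₂ (inj₂ β∈γ) = ⊥-elim (β∉α (proj₁ oα γ γ∈ β β∈γ))
        β⊆α : β ⊆ α
        β⊆α δ δ∈ with ihβ δ δ∈ oα (Ord-el β δ oβ δ∈)
        ... | inj₁ α∈δ = ⊥-elim (α∉β (proj₁ oβ δ δ∈ α α∈δ))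
        ... | inj₂ (inj₁ refl) = ⊥-elim (α∉β δ∈)
        ... | inj₂ (inj₂ δ∈α) = δ∈α

  V : ι → ι
  V = ∈-Recursion.rec (λ S → ℘ (⋃ S))

  V-in : ∀ u γ → u ⊆ ⋃ (Repl γ V) → u ∈ V γ
  V-in u γ u⊆ = subst (λ z → u ∈ z) (sym (∈-Recursion.rec-eq _ γ)) (℘-ax₂ _ u u⊆)

  V-out : ∀ u γ → u ∈ V γ → u ⊆ ⋃ (Repl γ V)
  V-out u γ u∈ = ℘-ax₁ _ u (subst (λ z → u ∈ z) (∈-Recursion.rec-eq _ γ) u∈)

  V-mono : ∀ β γ → β ⊆ γ → V β ⊆ V γ
  V-mono β γ β⊆γ x x∈ = V-in x γ (λ y y∈x → lift y (V-out x β x∈ y y∈x))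
    where
    stages⊆ : Repl β V ⊆ Repl γ V
    stages⊆ = Repl-all β V (λ z → z ∈ Repl γ V) (λ b b∈ → Repl-ax₂ γ V b (β⊆γ b b∈))
    lift : ∀ y → y ∈ ⋃ (Repl β V) → y ∈ ⋃ (Repl γ V)
    lift y y∈ with ⋃-ax₁ _ y y∈
    ... | Y , y∈Y , Y∈ = ⋃-ax₂ _ y Y y∈Y (stages⊆ Y Y∈)

  module SchröderBernstein (X Y : ι) (X⊆Y : X ⊆ Y) (h : ι → ι)
                           (h-into : ∀ y → y ∈ Y → h y ∈ X) (h-inj : InjectiveOn (λ y → y ∈ Y) h) where
    HasPre : ι → Set
    HasPre x = ∃ λ y → y ∈ Y × x ≡ h y

    data Chain : ι → Set where
      start : ∀ x → x ∈ X → ¬ HasPre x → Chain x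
      next  : ∀ y x → Chain y → x ≡ h y → Chain x

    chain-in-X : ∀ x → Chain x → x ∈ X
    chain-in-X x (start .x x∈ _) = x∈
    chain-in-X x (next y .x cy refl) = h-into y (X⊆Y y (chain-in-X y cy))

    chain-back : ∀ y → y ∈ Y → Chain (h y) → Chain y
    chain-back y y∈ (start _ _ none) = ⊥-elim (none (y , y∈ , refl))
    chain-back y y∈ (next y' _ cy' hy≡hy') =
      subst Chain (h-inj y' y (X⊆Y y' (chain-in-X y' cy')) y∈ (sym hy≡hy')) cy'

    pre : ι → ι
    pre x = ε ∅ (λ y → y ∈ Y × x ≡ h y)

    pre-spec : ∀ x → x ∈ X → ¬ Chain x → pre x ∈ Y × x ≡ h (pre x)
    pre-spec x x∈ off = choose _ (dne _ (λ none → off (start x x∈ none)))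

    φ : ι → ι
    φ x with lem (Chain x)
    ... | inj₁ _ = x
    ... | inj₂ _ = pre x

    φ-chain : ∀ x → Chain x → φ x ≡ x
    φ-chain x c with lem (Chain x)
    ... | inj₁ _ = refl
    ... | inj₂ off = ⊥-elim (off c)

    φ-cases : ∀ x → x ∈ X → (Chain x × φ x ≡ x) ⊎ (¬ Chain x × φ x ∈ Y × x ≡ h (φ x))
    φ-cases x x∈ with lem (Chain x)
    ... | inj₁ c = inj₁ (c , refl)
    ... | inj₂ off = inj₂ (off , pre-spec x x∈ off)

    φ-into : ∀ x → x ∈ X → φ x ∈ Y
    φ-into x x∈ with φ-cases x x∈
    ... | inj₁ (_ , φx≡x) = subst (λ z → z ∈ Y) (sym φx≡x) (X⊆Y x x∈)
    ... | inj₂ (_ , φx∈ , _) = φx∈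

    φ-separates : ∀ x x' → Chain x → φ x ≡ x → ¬ Chain x' → x' ≡ h (φ x') → ¬ (φ x ≡ φ x')
    φ-separates x x' cx φx≡x off x'≡ eq = off (next x x' cx (trans x'≡ (cong h (trans (sym eq) φx≡x))))

    φ-inj : InjectiveOn (λ x → x ∈ X) φ
    φ-inj x x' x∈ x'∈ eq with φ-cases x x∈ | φ-cases x' x'∈
    ... | inj₁ (_ , φx≡x) | inj₁ (_ , φx'≡x') = trans (sym φx≡x) (trans eq φx'≡x')
    ... | inj₂ (_ , _ , x≡) | inj₂ (_ , _ , x'≡) = trans x≡ (trans (cong h eq) (sym x'≡))
    ... | inj₁ (cx , φx≡x) | inj₂ (off , _ , x'≡) = ⊥-elim (φ-separates x x' cx φx≡x off x'≡ eq)
    ... | inj₂ (off , _ , x≡) | inj₁ (cx' , φx'≡x') = ⊥-elim (φ-separates x' x cx' φx'≡x' off x≡ (sym eq))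

    φ-onto : ∀ y → y ∈ Y → ∃ λ x → x ∈ X × y ≡ φ x
    φ-onto y y∈ with φ-cases (h y) (h-into y y∈)
    ... | inj₁ (c , _) =
      y , chain-in-X y (chain-back y y∈ c) , sym (φ-chain y (chain-back y y∈ c))
    ... | inj₂ (_ , φhy∈ , hy≡) = h y , h-into y y∈ , h-inj y _ y∈ φhy∈ hy≡

  schröder-bernstein : ∀ X Y → X ⊆ Y → (h : ι → ι) → (∀ y → y ∈ Y → h y ∈ X) →
                       InjectiveOn (λ y → y ∈ Y) h → ∃ λ f → BijOnto f X Y
  schröder-bernstein X Y X⊆Y h h-into h-inj = φ , φ-into , φ-inj , φ-onto
    where open SchröderBernstein X Y X⊆Y h h-into h-inj

  module ZFUniverse (U : ι) (U-trans : TransitiveSet U) (U-ZF : ZFClosed ⋃ ℘ Repl U) where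
    ⋃-closed : ∀ X → X ∈ U → ⋃ X ∈ U
    ⋃-closed = proj₁ U-ZF

    ℘-closed : ∀ X → X ∈ U → ℘ X ∈ U
    ℘-closed = proj₁ (proj₂ U-ZF)

    Repl-closed : ∀ X → X ∈ U → ∀ (F : ι → ι) → (∀ x → x ∈ X → F x ∈ U) → Repl X F ∈ U
    Repl-closed = proj₂ (proj₂ U-ZF)

    sub-closed : ∀ X → X ∈ U → ∀ Y → Y ⊆ X → Y ∈ U
    sub-closed X X∈ Y Y⊆ = U-trans (℘ X) (℘-closed X X∈) Y (℘-ax₂ X Y Y⊆)

    escape : ∀ A S → ¬ (A ∈ U) → S ∈ U → ∃ λ x → x ∈ A × ¬ (x ∈ S)
    escape A S A∉ S∈ = dne _ λ none →
      A∉ (sub-closed S S∈ A (λ x x∈ → dne _ (λ x∉ → none (x , x∈ , x∉))))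

    UOrd : ι → Set
    UOrd α = Ord α × α ∈ U

    V-closed : ∀ α → α ∈ U → V α ∈ U
    V-closed = ∈-ind (λ α → α ∈ U → V α ∈ U) ind
      where
      ind : ∀ α → (∀ β → β ∈ α → β ∈ U → V β ∈ U) → α ∈ U → V α ∈ U
      ind α ih α∈ = subst (λ z → z ∈ U) (sym (∈-Recursion.rec-eq _ α))
        (℘-closed _ (⋃-closed _ (Repl-closed α α∈ V (λ β β∈ → ih β β∈ (U-trans α α∈ β β∈)))))

    -- Burali-Forti: the ordinals of U form an ordinal, hence not a member of U
    OrdU : ι
    OrdU = sep U Ord

    OrdU-ord : Ord OrdU
    OrdU-ord = OrdU-trans , λ β β∈ → proj₁ (proj₂ (sep-out U Ord β β∈))
      where
      OrdU-trans : TransitiveSet OrdU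
      OrdU-trans α α∈ β β∈α with sep-out U Ord α α∈
      ... | α∈U , oα = sep-in U Ord β (U-trans α α∈U β β∈α) (Ord-el α β oα β∈α)

    OrdU∉U : ¬ (OrdU ∈ U)
    OrdU∉U OrdU∈ = ∈-irrefl OrdU (sep-in U Ord OrdU OrdU∈ OrdU-ord)

    no-ordinal-injection : ∀ (e : ι → ι) B → B ∈ U → (∀ α → UOrd α → e α ∈ B) → InjectiveOn UOrd e → ⊥
    no-ordinal-injection e B B∈ e-into e-inj = OrdU∉U (sub-closed _ preimages∈U OrdU covered)
      where
      Pre : ι → ι → Set
      Pre w α = UOrd α × e α ≡ w
      Image : ι
      Image = sep B (λ w → ∃ (Pre w))
      pick : ι → ι
      pick w = ε ∅ (Pre w)
      preimages∈U : Repl Image pick ∈ U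
      preimages∈U = Repl-closed Image (sub-closed B B∈ Image (λ w w∈ → proj₁ (sep-out B _ w w∈))) pick
        (λ w w∈ → proj₂ (proj₁ (choose (Pre w) (proj₂ (sep-out B _ w w∈)))))
      covered : OrdU ⊆ Repl Image pick
      covered α α∈ = subst (λ z → z ∈ Repl Image pick) (e-inj _ α (proj₁ picked) oα (proj₂ picked))
        (Repl-ax₂ Image pick (e α) (sep-in B _ (e α) (e-into α oα) (α , oα , refl)))
        where
        oα : UOrd α
        oα = proj₂ (sep-out U Ord α α∈) , proj₁ (sep-out U Ord α α∈)
        picked : Pre (e α) (pick (e α))
        picked = choose (Pre (e α)) (α , oα , refl)

    -- a member of U consisting of ordinals is bounded by an ordinal of U:
    -- take the ordinals that are subsets of its members
    ord-bound : ∀ A → A ∈ U → (∀ β → β ∈ A → Ord β) → ∃ λ γ → UOrd γ × A ⊆ γ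
    ord-bound A A∈ A-ord = γ , (γ-ord , γ∈U) , A⊆γ
      where
      Below : ι
      Below = ⋃ (Repl A ℘)
      below : ∀ x β → β ∈ A → x ⊆ β → x ∈ Below
      below x β β∈ x⊆β = ⋃-ax₂ _ x (℘ β) (℘-ax₂ β x x⊆β) (Repl-ax₂ A ℘ β β∈)
      γ : ι
      γ = sep Below Ord
      γ-trans : TransitiveSet γ
      γ-trans δ δ∈ e e∈δ with sep-out Below Ord δ δ∈
      ... | δ∈B , oδ with ⋃-ax₁ _ δ δ∈B
      ... | P , δ∈P , P∈ with Repl-ax₁ A ℘ P P∈
      ... | β , β∈ , refl =
        sep-in Below Ord e (below e β β∈ (proj₁ (A-ord β β∈) e (℘-ax₁ β δ δ∈P e e∈δ))) (Ord-el δ e oδ e∈δ)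
      γ-ord : Ord γ
      γ-ord = γ-trans , λ δ δ∈ → proj₁ (proj₂ (sep-out Below Ord δ δ∈))
      γ∈U : γ ∈ U
      γ∈U = sub-closed Below (⋃-closed _ (Repl-closed A A∈ ℘ (λ β β∈ → ℘-closed β (U-trans A A∈ β β∈))))
        γ (λ x x∈ → proj₁ (sep-out Below Ord x x∈))
      A⊆γ : A ⊆ γ
      A⊆γ β β∈ = sep-in Below Ord β (below β β β∈ (λ x x∈ → x∈)) (A-ord β β∈)

    Ranked : ι → ι → Set
    Ranked u γ = UOrd γ × u ∈ V γ

    rank : ∀ u → u ∈ U → ∃ (Ranked u)
    rank = ∈-ind (λ u → u ∈ U → ∃ (Ranked u)) ind
      where
      ind : ∀ u → (∀ v → v ∈ u → v ∈ U → ∃ (Ranked v)) → u ∈ U → ∃ (Ranked u)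
      ind u ih u∈ = γ , oγ , V-in u γ (λ v v∈ →
          ⋃-ax₂ _ v (V (ρ v)) (proj₂ (ρ-ranked v v∈)) (Repl-ax₂ γ V (ρ v) (ρs⊆γ (ρ v) (Repl-ax₂ u ρ v v∈))))
        where
        ρ : ι → ι
        ρ v = ε ∅ (Ranked v)
        ρ-ranked : ∀ v → v ∈ u → Ranked v (ρ v)
        ρ-ranked v v∈ = choose (Ranked v) (ih v v∈ (U-trans u u∈ v v∈))
        bound : ∃ λ γ → UOrd γ × Repl u ρ ⊆ γ
        bound = ord-bound (Repl u ρ) (Repl-closed u u∈ ρ (λ v v∈ → proj₂ (proj₁ (ρ-ranked v v∈))))
          (Repl-all u ρ Ord (λ v v∈ → proj₁ (proj₁ (ρ-ranked v v∈))))
        γ : ι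
        γ = proj₁ bound
        oγ : UOrd γ
        oγ = proj₁ (proj₂ bound)
        ρs⊆γ : Repl u ρ ⊆ γ
        ρs⊆γ = proj₂ (proj₂ bound)

    -- transfinite choice of fresh elements along the ordinals of U:
    -- enum α satisfies Fresh {enum β | β ∈ α}, so enum is injective on ordinals
    module FreshEnum (Fresh : ι → ι → Set)
                     (fresh-in : ∀ S x → Fresh S x → x ∈ U)
                     (fresh-new : ∀ S x → Fresh S x → ¬ (x ∈ S))
                     (fresh-ex : ∀ S → S ∈ U → ∃ (Fresh S)) where
      enum : ι → ι
      enum = ∈-Recursion.rec (λ S → ε ∅ (Fresh S))

      enum-fresh : ∀ α → α ∈ U → Fresh (Repl α enum) (enum α)
      enum-fresh = ∈-ind (λ α → α ∈ U → Fresh (Repl α enum) (enum α)) ind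
        where
        ind : ∀ α → (∀ β → β ∈ α → β ∈ U → Fresh (Repl β enum) (enum β)) → α ∈ U →
              Fresh (Repl α enum) (enum α)
        ind α ih α∈ = subst (Fresh (Repl α enum)) (sym (∈-Recursion.rec-eq _ α))
          (choose (Fresh (Repl α enum)) (fresh-ex _ (Repl-closed α α∈ enum
            (λ β β∈ → fresh-in _ _ (ih β β∈ (U-trans α α∈ β β∈))))))

      enum-inj : InjectiveOn UOrd enum
      enum-inj α β (oα , α∈) (oβ , β∈) eq with trichotomy α β oα oβ
      ... | inj₁ α∈β = ⊥-elim (fresh-new _ _ (enum-fresh β β∈)
              (subst (λ z → z ∈ Repl β enum) eq (Repl-ax₂ β enum α α∈β)))
      ... | inj₂ (inj₁ α≡β) = α≡β
      ... | inj₂ (inj₂ β∈α) = ⊥-elim (fresh-new _ _ (enum-fresh α α∈)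
              (subst (λ z → z ∈ Repl α enum) (sym eq) (Repl-ax₂ α enum β β∈α)))

    -- u is an element of U outside S of least rank
    LeastNew : ι → ι → Set
    LeastNew S u = u ∈ U × ¬ (u ∈ S) × (∀ γ w → UOrd γ → w ∈ U → ¬ (w ∈ S) → w ∈ V γ → u ∈ V γ)

    NewAt : ι → ι → Set
    NewAt S γ = UOrd γ × ∃ λ w → w ∈ U × ¬ (w ∈ S) × w ∈ V γ

    least-new : ∀ S → S ∈ U → ∃ (LeastNew S)
    least-new S S∈ with escape U S (∈-irrefl U) S∈
    ... | w₀ , w₀∈ , w₀∉ with rank w₀ w₀∈
    ... | γ₀ , oγ₀ , w₀V with ∈-minimal (NewAt S) γ₀ (oγ₀ , w₀ , w₀∈ , w₀∉ , w₀V)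
    ... | γ , ((oγ , γ∈) , u , u∈ , u∉ , uV) , minimal = u , u∈ , u∉ , least
      where
      least : ∀ δ w → UOrd δ → w ∈ U → ¬ (w ∈ S) → w ∈ V δ → u ∈ V δ
      least δ w (oδ , δ∈) w∈ w∉ wV with trichotomy γ δ oγ oδ
      ... | inj₁ γ∈δ = V-mono γ δ (proj₁ oδ γ γ∈δ) u uV
      ... | inj₂ (inj₁ refl) = uV
      ... | inj₂ (inj₂ δ∈γ) = ⊥-elim (minimal δ δ∈γ ((oδ , δ∈) , w , w∈ , w∉ , wV))

    -- enumeration of U by its ordinals, in order of rank
    open FreshEnum LeastNew (λ _ _ → proj₁) (λ _ _ new → proj₁ (proj₂ new)) least-new
      renaming (enum to E; enum-fresh to E-least; enum-inj to E-inj)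

    -- E is onto U: a missed u would keep every E α inside V (rank u) ∈ U
    E-onto : ∀ u → u ∈ U → ∃ λ α → UOrd α × E α ≡ u
    E-onto u u∈ = dne _ (λ missed → unreached missed (rank u u∈))
      where
      unreached : ¬ (∃ λ α → UOrd α × E α ≡ u) → ∃ (Ranked u) → ⊥
      unreached missed (γ , oγ , uV) = no-ordinal-injection E (V γ) (V-closed γ (proj₂ oγ)) E-below E-inj
        where
        not-yet : ∀ α → UOrd α → ¬ (u ∈ Repl α E)
        not-yet α (oα , α∈) u∈R with Repl-ax₁ α E u u∈R
        ... | β , β∈ , u≡ = missed (β , (Ord-el α β oα β∈ , U-trans α α∈ β β∈) , sym u≡)
        E-below : ∀ α → UOrd α → E α ∈ V γ
        E-below α oα = proj₂ (proj₂ (E-least α (proj₂ oα))) γ u oγ u∈ (not-yet α oα) uV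

    module LargeSubset (X : ι) (X⊆U : X ⊆ U) (X∉U : ¬ (X ∈ U)) where
      NewIn : ι → ι → Set
      NewIn S x = x ∈ X × ¬ (x ∈ S)

      open FreshEnum NewIn (λ _ x new → X⊆U x (proj₁ new)) (λ _ _ → proj₂) (λ S → escape X S X∉U)
        renaming (enum to g; enum-fresh to g-new; enum-inj to g-inj)

      index : ι → ι
      index u = ε ∅ (λ α → UOrd α × E α ≡ u)

      index-spec : ∀ u → u ∈ U → UOrd (index u) × E (index u) ≡ u
      index-spec u u∈ = choose _ (E-onto u u∈)

      embed : ι → ι
      embed u = g (index u)

      embed-into : ∀ u → u ∈ U → embed u ∈ X
      embed-into u u∈ = proj₁ (g-new (index u) (proj₂ (proj₁ (index-spec u u∈))))

      embed-inj : InjectiveOn (λ u → u ∈ U) embed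
      embed-inj u v u∈ v∈ eq =
        trans (sym (proj₂ (index-spec u u∈)))
          (trans (cong E (g-inj _ _ (proj₁ (index-spec u u∈)) (proj₁ (index-spec v v∈)) eq))
            (proj₂ (index-spec v v∈)))

    large-or-member : ∀ X → X ⊆ U → (∃ λ (f : ι → ι) → BijOnto f X U) ⊎ X ∈ U
    large-or-member X X⊆U with lem (X ∈ U)
    ... | inj₁ X∈U = inj₂ X∈U
    ... | inj₂ X∉U = inj₁ (schröder-bernstein X U X⊆U embed embed-into embed-inj)
      where open LargeSubset X X⊆U X∉U

theorem5 : (T : HOTG) → let open HOTG T in let open SetNotions _∈_ in
    ∀ N → ∃ λ M →
    N ∈ M
    × (∀ X → X ∈ M → ∀ Y → Y ⊆ X → Y ∈ M)
    × (∀ X → X ∈ M → ∃ λ Z → Z ∈ M × (∀ Y → Y ⊆ X → Y ∈ Z))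
    × (∀ X → X ⊆ M → (∃ λ (f : ι → ι) → BijOnto f X M) ⊎ X ∈ M)
theorem5 T N =
    UnivOf N
  , UnivOf-in N
  , sub-closed
  , (λ X X∈ → ℘ X , ℘-closed X X∈ , ℘-ax₂ X)
  , large-or-member
  where
  open HOTG T
  open SetTheory T
  open ZFUniverse (UnivOf N) (UnivOf-trans N) (UnivOf-ZF N)
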